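{- Let $P$ be a naturally labeled poset on $[n]$ and let $0\le k\le n-1$. (a) If $P$ has exactly $j$ maximal elements, then exactly $\binom{j-1}{k}$ linear extensions of $P$ have descent set $\{n-k,n-k+1,\dots,n-1\}$. (b) If $P$ has exactly $j$ minimal elements, then exactly $\binom{j-1}{k}$ linear extensions of $P$ have descent set $\{1,2,\dots,k\}$.
   Context: A poset $(P,\preceq)$ on ground set $[n]$ is naturally labeled if $x\preceq y$ implies $x\le y$ as integers. A linear extension of $P$ is a permutation $\pi=\pi(1)\pi(2)\cdots\pi(n)$ of $[n]$ such that $x\preceq y$ implies $\pi^{ -1}(x)\le\pi^{ -1}(y)$. Its descent set is $\mathrm{des}(\pi)=\{i\in[n-1]:\pi(i)>\pi(i+1)\}$. -}

module Defs where

open import Data.Nat using (ℕ; suc; _∸_) renaming (_≤_ to _≤ℕ_)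
open import Data.Fin using (Fin; toℕ; _≤_; _<_)
open import Data.Vec using (Vec; lookup)
open import Data.List using (List; length)
open import Data.List.Membership.Propositional using (_∈_)
open import Data.List.Relation.Unary.Unique.Propositional using (Unique)
open import Data.Product using (Σ; _×_)
open import Function.Bundles using (_⇔_)
open import Relation.Binary.PropositionalEquality using (_≡_)
open import Relation.Binary.Structures using (IsPartialOrder)

HasExactly : {A : Set} → (A → Set) → ℕ → Set
HasExactly {A} P m =
  Σ (List A) λ L → Unique L × (∀ x → (x ∈ L) ⇔ P x) × (length L ≡ m)

-- A naturally labeled poset on [n] (elements represented as Fin n, i.e. 0..n-1,
-- with the integer order on labels being the order of Fin n).
record NatLabeledPoset (n : ℕ) : Set₁ where
  field
    _≼_       : Fin n → Fin n → Set
    isPO      : IsPartialOrder _≡_ _≼_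
    natural   : ∀ {x y} → x ≼ y → x ≤ y

open NatLabeledPoset public

IsMaximal : {n : ℕ} → NatLabeledPoset n → Fin n → Set
IsMaximal {n} P x = ∀ (y : Fin n) → _≼_ P x y → y ≡ x

IsMinimal : {n : ℕ} → NatLabeledPoset n → Fin n → Set
IsMinimal {n} P x = ∀ (y : Fin n) → _≼_ P y x → y ≡ x

-- A permutation of [n] in one-line notation: w = π(1)…π(n), lookup w p = π(p+1).
IsPermutation : {n : ℕ} → Vec (Fin n) n → Set
IsPermutation {n} w = ∀ (p q : Fin n) → lookup w p ≡ lookup w q → p ≡ q

-- Linear extension: x ≼ y implies π⁻¹(x) ≤ π⁻¹(y), i.e. π(p) ≼ π(q) ⇒ p ≤ q.
IsLinearExtension : {n : ℕ} → NatLabeledPoset n → Vec (Fin n) n → Set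
IsLinearExtension {n} P w =
  IsPermutation w × (∀ (p q : Fin n) → _≼_ P (lookup w p) (lookup w q) → p ≤ q)

-- des(π) = S, for S a predicate on ℕ: for every i ∈ [n-1] (i = p+1 where
-- positions p, q = p+1 are 0-based), π(i) > π(i+1) iff S i.
DescentSetIs : {n : ℕ} → Vec (Fin n) n → (ℕ → Set) → Set
DescentSetIs {n} w S =
  ∀ (p q : Fin n) → toℕ q ≡ suc (toℕ p) →
    ((lookup w q < lookup w p) ⇔ S (suc (toℕ p)))

FinalSegment : ℕ → ℕ → ℕ → Set
FinalSegment n k i = n ∸ k ≤ℕ i

InitialSegment : ℕ → ℕ → Set
InitialSegment k i = i ≤ℕ k

module Submission where

-- A permutation of [n] with descent set {n-k, …, n-1} increases up to position
-- n - k and decreases afterwards, so its increasing run ends with the top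
-- label n.  It is therefore the "peak word" of the set B of its last k
-- letters: the labels outside B increasingly, followed by B decreasingly.
-- For a naturally labeled P such a word is a linear extension exactly when
-- every element of B is maximal.  So these linear extensions correspond to the
-- k-subsets of the j - 1 maximal elements other than n, which is part (a).
-- Part (b) follows by duality: relabelling x ↦ n + 1 - x and reading words
-- backwards exchanges minimal and maximal elements and turns the descent set
-- {1, …, k} into {n-k, …, n-1}.

open import Defs
open import Data.Nat using (ℕ; _<_; _∸_)
open import Data.Nat.Combinatorics using (_C_)
open import Data.Fin using (Fin)
open import Data.Vec using (Vec)
open import Data.Product using (_×_)

open import Data.Nat as ℕ using (zero; suc; _+_; z≤n; s≤s)
import Data.Nat.Properties as ℕP
open import Data.Nat.Combinatorics using (nCk+nC[k+1]≡[n+1]C[k+1])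
open import Data.Fin as F using (zero; suc; toℕ)
import Data.Fin.Properties as FP
open import Data.Vec as V using ([]; _∷_; lookup; toList)
import Data.Vec.Properties as VP
open import Data.Vec.Membership.Propositional.Properties using (∈-toList⁺) renaming (∈-lookup to ∈-lookupᵥ)
open import Data.List as L using (List; []; _∷_; length; _++_; map; filter)
import Data.List.Properties as LP
open import Data.List.Membership.Propositional using (_∈_; _∉_)
open import Data.List.Membership.Propositional.Properties
open import Data.List.Membership.Propositional.Properties.WithK using (unique∧set⇒bag)
import Data.List.Membership.DecPropositional as DecMembership
open import Data.List.Relation.Unary.Any using (here; there)
open import Data.List.Relation.Unary.All as All using (All; []; _∷_)
open import Data.List.Relation.Unary.AllPairs as AP using (AllPairs; []; _∷_)
import Data.List.Relation.Unary.AllPairs.Properties as APP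
import Data.List.Relation.Unary.All.Properties as AllP
open import Data.List.Relation.Unary.Unique.Propositional using (Unique)
import Data.List.Relation.Unary.Unique.Propositional.Properties as UP
open import Data.List.Relation.Binary.BagAndSetEquality using (∼bag⇒↭)
open import Data.List.Relation.Binary.Permutation.Propositional.Properties using (↭-length)
open import Data.Product using (∃; ∃₂; _,_; proj₁; proj₂)
open import Data.Sum using (_⊎_; inj₁; inj₂)
open import Data.Empty using (⊥; ⊥-elim)
open import Data.Unit using (⊤; tt)
open import Function.Bundles using (_⇔_; mk⇔; Equivalence)
open import Relation.Nullary using (¬_; Dec; yes; no)
open import Relation.Nullary.Decidable using (¬?)
open import Relation.Unary using (Decidable)
open import Relation.Binary.Definitions using (DecidableEquality; tri<; tri≈; tri>)
open import Data.List.Relation.Unary.Linked using (Linked; []; [-]; _∷_)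
import Data.List.Relation.Unary.Linked.Properties as LinkedP
open import Relation.Binary.PropositionalEquality

module ⇔ = Equivalence

unique-length : {A : Set} {xs ys : List A} → Unique xs → Unique ys →
  (∀ z → z ∈ xs ⇔ z ∈ ys) → length xs ≡ length ys
unique-length ux uy same = ↭-length (∼bag⇒↭ (unique∧set⇒bag ux uy (λ {z} → same z)))

sorted-unique : {A : Set} {R : A → A → Set} → (∀ {a b} → R a b → ¬ R b a) →
  {xs ys : List A} → AllPairs R xs → AllPairs R ys → (∀ z → z ∈ xs ⇔ z ∈ ys) → xs ≡ ys
sorted-unique asym [] [] same = refl
sorted-unique asym [] (_∷_ {y} _ _) same with ⇔.from (same y) (here refl)
... | ()
sorted-unique asym (_∷_ {x} _ _) [] same with ⇔.to (same x) (here refl)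
... | ()
sorted-unique {R = R} asym {x ∷ xs} {y ∷ ys} (x<xs ∷ sxs) (y<ys ∷ sys) same
  with heads-equal
  where
  heads-equal : x ≡ y
  heads-equal with ⇔.to (same x) (here refl) | ⇔.from (same y) (here refl)
  ... | here x≡y   | _          = x≡y
  ... | there _    | here y≡x   = sym y≡x
  ... | there x∈ys | there y∈xs = ⊥-elim (asym (All.lookup x<xs y∈xs) (All.lookup y<ys x∈ys))
... | refl = cong (x ∷_) (sorted-unique asym sxs sys (λ z → mk⇔ (tail x<xs (⇔.to (same z))) (tail y<ys (⇔.from (same z)))))
  where
  -- x is R-below every later element, so it cannot reoccur in a tail
  tail : ∀ {zs ws z} → All (R x) zs → (z ∈ x ∷ zs → z ∈ x ∷ ws) → z ∈ zs → z ∈ ws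
  tail x<zs f z∈zs with f (there z∈zs)
  ... | here refl = ⊥-elim (asym (All.lookup x<zs z∈zs) (All.lookup x<zs z∈zs))
  ... | there z∈ws = z∈ws

AllPairs-++⁻ : {A : Set} {R : A → A → Set} (xs : List A) {ys : List A} → AllPairs R (xs ++ ys) →
  AllPairs R xs × AllPairs R ys × All (λ x → All (R x) ys) xs
AllPairs-++⁻ [] rys = [] , rys , []
AllPairs-++⁻ (x ∷ xs) (rx ∷ rxs) with AllPairs-++⁻ xs rxs
... | rxs' , rys , rxsys = AllP.++⁻ˡ xs rx ∷ rxs' , rys , AllP.++⁻ʳ xs rx ∷ rxsys

AllPairs-either : {A : Set} {R : A → A → Set} {xs : List A} → AllPairs R xs →
  ∀ {a b} → a ∈ xs → b ∈ xs → a ≢ b → R a b ⊎ R b a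
AllPairs-either (ra ∷ _) (here refl) (here refl) a≢b = ⊥-elim (a≢b refl)
AllPairs-either (ra ∷ _) (here refl) (there b∈) _ = inj₁ (All.lookup ra b∈)
AllPairs-either (rb ∷ _) (there a∈) (here refl) _ = inj₂ (All.lookup rb a∈)
AllPairs-either (_ ∷ rs) (there a∈) (there b∈) a≢b = AllPairs-either rs a∈ b∈ a≢b

++-cancel-length : {A : Set} (xs xs' : List A) {ys ys' : List A} → length xs ≡ length xs' →
  xs ++ ys ≡ xs' ++ ys' → ys ≡ ys'
++-cancel-length [] [] _ same = same
++-cancel-length (x ∷ xs) (x' ∷ xs') len same = ++-cancel-length xs xs' (ℕP.suc-injective len) (LP.∷-injectiveʳ same)

AllPairs-map-members : {A : Set} {R R' : A → A → Set} {xs : List A} → AllPairs R xs →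
  (∀ {a b} → a ∈ xs → b ∈ xs → R a b → R' a b) → AllPairs R' xs
AllPairs-map-members [] f = []
AllPairs-map-members (rx ∷ rxs) f =
  All.tabulate (λ b∈ → f (here refl) (there b∈) (All.lookup rx b∈)) ∷
  AllPairs-map-members rxs (λ a∈ b∈ → f (there a∈) (there b∈))

unique-map-on : {A B : Set} (f : A → B) {xs : List A} → Unique xs →
  (∀ {a b} → a ∈ xs → b ∈ xs → f a ≡ f b → a ≡ b) → Unique (map f xs)
unique-map-on f [] inj = []
unique-map-on f {x ∷ xs} (x∉xs ∷ u) inj =
  All.tabulate distinct ∷ unique-map-on f u (λ a∈ b∈ → inj (there a∈) (there b∈))
  where
  distinct : ∀ {y} → y ∈ map f xs → f x ≢ y
  distinct y∈ fx≡y with ∈-map⁻ f y∈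
  ... | b , b∈ , refl = All.lookup x∉xs b∈ (inj (here refl) (there b∈) fx≡y)

count-image : {A B : Set} {Q : B → Set} (f : A → B) (L : List A) → Unique L →
  (∀ {a b} → a ∈ L → b ∈ L → f a ≡ f b → a ≡ b) →
  (∀ y → Q y ⇔ (∃ λ a → a ∈ L × y ≡ f a)) → HasExactly Q (length L)
count-image {Q = Q} f L u inj image = map f L , unique-map-on f u inj , members , LP.length-map f L
  where
  members : ∀ y → y ∈ map f L ⇔ Q y
  members y = mk⇔ (λ y∈ → ⇔.from (image y) (∈-map⁻ f y∈))
                  (λ qy → let (a , a∈ , y≡fa) = ⇔.to (image y) qy in subst (_∈ map f L) (sym y≡fa) (∈-map⁺ f a∈))

count-involution : {A : Set} {P Q : A → Set} {m : ℕ} (g : A → A) → (∀ x → g (g x) ≡ x) →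
  (∀ x → P x ⇔ Q (g x)) → HasExactly P m → HasExactly Q m
count-involution {Q = Q} g gg P⇔Qg (L , u , members , refl) =
  count-image g L u (λ {a} {b} _ _ ga≡gb → trans (sym (gg a)) (trans (cong g ga≡gb) (gg b))) image
  where
  image : ∀ y → Q y ⇔ (∃ λ a → a ∈ L × y ≡ g a)
  image y = mk⇔ (λ qy → g y , ⇔.from (members (g y)) (⇔.from (P⇔Qg (g y)) (subst Q (sym (gg y)) qy)) , sym (gg y))
                (λ { (a , a∈ , refl) → ⇔.to (P⇔Qg a) (⇔.to (members a) a∈) })

count-remove : {A : Set} {P : A → Set} {m : ℕ} → DecidableEquality A → ∀ {x} → P x →
  HasExactly P m → HasExactly (λ y → P y × y ≢ x) (m ∸ 1)
count-remove {A} {P} _≟_ {x} px (L , u , members , refl) =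
  L' , UP.filter⁺ ≢x? u , members' , cong (_∸ 1) (sym (unique-length u (x≢L' ∷ UP.filter⁺ ≢x? u) split))
  where
  ≢x? : Decidable (_≢ x)
  ≢x? y = ¬? (y ≟ x)
  L' : List A
  L' = filter ≢x? L
  members' : ∀ y → y ∈ L' ⇔ (P y × y ≢ x)
  members' y = mk⇔ (λ y∈ → let (y∈L , y≢x) = ∈-filter⁻ ≢x? {xs = L} y∈ in ⇔.to (members y) y∈L , y≢x)
                   (λ (py , y≢x) → ∈-filter⁺ ≢x? (⇔.from (members y) py) y≢x)
  x≢L' : All (x ≢_) L'
  x≢L' = All.tabulate (λ y∈ x≡y → proj₂ (∈-filter⁻ ≢x? {xs = L} y∈) (sym x≡y))
  split : ∀ y → y ∈ L ⇔ y ∈ x ∷ L'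
  split y with y ≟ x
  ... | yes refl = mk⇔ (λ _ → here refl) (λ _ → ⇔.from (members x) px)
  ... | no y≢x = mk⇔ (λ y∈ → there (∈-filter⁺ ≢x? y∈ y≢x))
                     (λ { (here y≡x) → ⊥-elim (y≢x y≡x) ; (there y∈) → proj₁ (∈-filter⁻ ≢x? {xs = L} y∈) })

-- k-element sublists.  'choose k xs' lists the length-k sublists of xs, so it
-- enumerates the k-subsets of a duplicate-free list, each exactly once.
choose : {A : Set} → ℕ → List A → List (List A)
choose zero xs = [] ∷ []
choose (suc k) [] = []
choose (suc k) (x ∷ xs) = map (x ∷_) (choose k xs) ++ choose (suc k) xs

length-choose : {A : Set} (k : ℕ) (xs : List A) → length (choose k xs) ≡ length xs C k
length-choose zero xs = refl
length-choose (suc k) [] = refl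
length-choose (suc k) (x ∷ xs) = begin
  length (map (x ∷_) (choose k xs) ++ choose (suc k) xs)
    ≡⟨ LP.length-++ (map (x ∷_) (choose k xs)) ⟩
  length (map (x ∷_) (choose k xs)) + length (choose (suc k) xs)
    ≡⟨ cong₂ _+_ (trans (LP.length-map _ (choose k xs)) (length-choose k xs)) (length-choose (suc k) xs) ⟩
  length xs C k + length xs C suc k
    ≡⟨ nCk+nC[k+1]≡[n+1]C[k+1] (length xs) k ⟩
  suc (length xs) C suc k ∎
  where open ≡-Reasoning

∈-choose-suc⁻ : {A : Set} {k : ℕ} (x : A) (xs : List A) {s : List A} → s ∈ choose (suc k) (x ∷ xs) →
  (∃ λ s' → s' ∈ choose k xs × s ≡ x ∷ s') ⊎ s ∈ choose (suc k) xs
∈-choose-suc⁻ {k = k} x xs s∈ with ∈-++⁻ (map (x ∷_) (choose k xs)) s∈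
... | inj₁ s∈heads = inj₁ (∈-map⁻ (x ∷_) s∈heads)
... | inj₂ s∈rest = inj₂ s∈rest

choose-⊆ : {A : Set} (k : ℕ) (xs : List A) {s : List A} → s ∈ choose k xs → ∀ {z} → z ∈ s → z ∈ xs
choose-⊆ zero xs (here refl) ()
choose-⊆ (suc k) (x ∷ xs) s∈ z∈s with ∈-choose-suc⁻ x xs s∈
... | inj₂ s∈rest = there (choose-⊆ (suc k) xs s∈rest z∈s)
... | inj₁ (s' , s'∈ , refl) with z∈s
...   | here refl = here refl
...   | there z∈s' = there (choose-⊆ k xs s'∈ z∈s')

choose-length : {A : Set} (k : ℕ) (xs : List A) {s : List A} → s ∈ choose k xs → length s ≡ k
choose-length zero xs (here refl) = refl
choose-length (suc k) (x ∷ xs) s∈ with ∈-choose-suc⁻ x xs s∈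
... | inj₂ s∈rest = choose-length (suc k) xs s∈rest
... | inj₁ (s' , s'∈ , refl) = cong suc (choose-length k xs s'∈)

choose-unique : {A : Set} (k : ℕ) (xs : List A) → Unique xs → Unique (choose k xs)
choose-unique zero xs u = [] ∷ []
choose-unique (suc k) [] u = []
choose-unique (suc k) (x ∷ xs) (x∉xs ∷ u) =
  APP.++⁺ (UP.map⁺ LP.∷-injectiveʳ (choose-unique k xs u)) (choose-unique (suc k) xs u)
    (All.tabulate λ a∈ → All.tabulate λ b∈ a≡b → head-absent a∈ b∈ a≡b)
  where
  -- sublists through the head contain x, the others do not
  head-absent : ∀ {a b} → a ∈ map (x ∷_) (choose k xs) → b ∈ choose (suc k) xs → a ≢ b
  head-absent a∈ b∈ refl with ∈-map⁻ (x ∷_) a∈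
  ... | _ , _ , refl = All.lookup x∉xs (choose-⊆ (suc k) xs b∈ (here refl)) refl

choose-element-unique : {A : Set} (k : ℕ) (xs : List A) → Unique xs → {s : List A} → s ∈ choose k xs → Unique s
choose-element-unique zero xs u (here refl) = []
choose-element-unique (suc k) (x ∷ xs) (x∉xs ∷ u) s∈ with ∈-choose-suc⁻ x xs s∈
... | inj₂ s∈rest = choose-element-unique (suc k) xs u s∈rest
... | inj₁ (s' , s'∈ , refl) =
  All.tabulate (λ z∈s' → All.lookup x∉xs (choose-⊆ k xs s'∈ z∈s')) ∷ choose-element-unique k xs u s'∈

choose-members-injective : {A : Set} (k : ℕ) (xs : List A) → Unique xs → {a b : List A} →
  a ∈ choose k xs → b ∈ choose k xs → (∀ z → z ∈ a ⇔ z ∈ b) → a ≡ b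
choose-members-injective zero xs u (here refl) (here refl) same = refl
choose-members-injective (suc k) (x ∷ xs) (x∉xs ∷ u) a∈ b∈ same with ∈-choose-suc⁻ x xs a∈ | ∈-choose-suc⁻ x xs b∈
... | inj₁ (a' , a'∈ , refl) | inj₁ (b' , b'∈ , refl) =
  cong (x ∷_) (choose-members-injective k xs u a'∈ b'∈ λ z → mk⇔ (drop-x a'∈ (⇔.to (same z))) (drop-x b'∈ (⇔.from (same z))))
  where
  -- x does not occur in a sublist of xs, so membership in x ∷ _ passes to the tail
  drop-x : ∀ {s t z} → s ∈ choose k xs → (z ∈ x ∷ s → z ∈ x ∷ t) → z ∈ s → z ∈ t
  drop-x s∈ f z∈s with f (there z∈s)
  ... | here refl = ⊥-elim (All.lookup x∉xs (choose-⊆ k xs s∈ z∈s) refl)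
  ... | there z∈t = z∈t
... | inj₁ (a' , a'∈ , refl) | inj₂ b∈rest =
  ⊥-elim (All.lookup x∉xs (choose-⊆ (suc k) xs b∈rest (⇔.to (same x) (here refl))) refl)
... | inj₂ a∈rest | inj₁ (b' , b'∈ , refl) =
  ⊥-elim (All.lookup x∉xs (choose-⊆ (suc k) xs a∈rest (⇔.from (same x) (here refl))) refl)
... | inj₂ a∈rest | inj₂ b∈rest = choose-members-injective (suc k) xs u a∈rest b∈rest same

filter∈choose : {A : Set} {P : A → Set} (P? : Decidable P) (xs : List A) →
  filter P? xs ∈ choose (length (filter P? xs)) xs
filter∈choose P? [] = here refl
filter∈choose P? (x ∷ xs) with P? x
... | yes _ = ∈-++⁺ˡ (∈-map⁺ (x ∷_) (filter∈choose P? xs))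
... | no _ with filter P? xs | filter∈choose P? xs
...   | [] | _ = here refl
...   | y ∷ ys | ∈rest = ∈-++⁺ʳ (map (x ∷_) (choose (length ys) xs)) ∈rest

choose-complete : {A : Set} → DecidableEquality A → (k : ℕ) (xs : List A) → Unique xs →
  {B : List A} → Unique B → (∀ {z} → z ∈ B → z ∈ xs) → length B ≡ k →
  ∃ λ s → s ∈ choose k xs × (∀ z → z ∈ s ⇔ z ∈ B)
choose-complete _≟_ k xs u {B} uB B⊆xs refl =
  filter (_∈? B) xs , subst (λ l → filter (_∈? B) xs ∈ choose l xs) same-length (filter∈choose (_∈? B) xs) , members
  where
  open DecMembership _≟_ using (_∈?_)
  members : ∀ z → z ∈ filter (_∈? B) xs ⇔ z ∈ B
  members z = mk⇔ (λ z∈ → proj₂ (∈-filter⁻ (_∈? B) {xs = xs} z∈)) (λ z∈B → ∈-filter⁺ (_∈? B) (B⊆xs z∈B) z∈B)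
  same-length : length (filter (_∈? B) xs) ≡ length B
  same-length = unique-length (UP.filter⁺ (_∈? B) u) uB members

-- Words as vectors versus words as lists.  The statement speaks about vectors
-- and positions; the combinatorics is easier on lists.

∈toList⇒lookup : {A : Set} {m : ℕ} (w : Vec A m) {y : A} → y ∈ toList w → ∃ λ p → lookup w p ≡ y
∈toList⇒lookup (x ∷ w) (here refl) = zero , refl
∈toList⇒lookup (x ∷ w) (there y∈) with ∈toList⇒lookup w y∈
... | p , wp≡y = suc p , wp≡y

AllPairs-toList : {A : Set} {R : A → A → Set} {m : ℕ} (w : Vec A m) →
  AllPairs R (toList w) ⇔ (∀ p q → p F.< q → R (lookup w p) (lookup w q))
AllPairs-toList w = mk⇔ (to w) (from w)
  where
  to : ∀ {A R m} (w : Vec A m) → AllPairs R (toList w) → ∀ p q → p F.< q → R (lookup w p) (lookup w q)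
  to (x ∷ w) (rx ∷ _) zero (suc q) _ = All.lookup rx (∈-toList⁺ (∈-lookupᵥ q w))
  to (x ∷ w) (_ ∷ rw) (suc p) (suc q) (s≤s p<q) = to w rw p q p<q
  from : ∀ {A R m} (w : Vec A m) → (∀ p q → p F.< q → R (lookup w p) (lookup w q)) → AllPairs R (toList w)
  from [] _ = []
  from {R = R} (x ∷ w) r = All.tabulate head-related ∷ from w (λ p q p<q → r (suc p) (suc q) (s≤s p<q))
    where
    head-related : ∀ {y} → y ∈ toList w → R x y
    head-related y∈ with ∈toList⇒lookup w y∈
    ... | p , refl = r zero (suc p) (s≤s z≤n)

injective⇒surjective : {n : ℕ} (f : Fin n → Fin n) → (∀ p q → f p ≡ f q → p ≡ q) → ∀ x → ∃ λ p → f p ≡ x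
injective⇒surjective {suc m} f inj x with FP.any? (λ p → f p FP.≟ x)
... | yes hit = hit
... | no miss with FP.pigeonhole (ℕP.n<1+n m) (λ p → F.punchOut {i = x} {j = f p} (λ x≡fp → miss (p , sym x≡fp)))
... | i , j , i<j , same = ⊥-elim (FP.<⇒≢ i<j (inj i j (FP.punchOut-injective
        (λ x≡fi → miss (i , sym x≡fi)) (λ x≡fj → miss (j , sym x≡fj)) same)))

toList-injective : {A : Set} {m : ℕ} (v w : Vec A m) → toList v ≡ toList w → v ≡ w
toList-injective v w same = trans (sym (VP.cast-is-id refl v)) (VP.toList-injective refl v w same)

listToVec : {A : Set} {m : ℕ} (l : List A) → length l ≡ m → Vec A m
listToVec l len = V.cast len (V.fromList l)

toList-listToVec : {A : Set} {m : ℕ} (l : List A) (len : length l ≡ m) → toList (listToVec l len) ≡ l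
toList-listToVec l len = trans (VP.toList-cast len (V.fromList l)) (VP.toList∘fromList l)

-- Descent sets of words over [n].  'Descents S l' says: position i ≥ 1 of l
-- is a descent exactly when S i; 'VecDescents' is the positional form used in
-- the statement ('DescentSetIs' is its instance of length n).

Descents : {n : ℕ} → (ℕ → Set) → List (Fin n) → Set
Descents S [] = ⊤
Descents S (x ∷ []) = ⊤
Descents S (x ∷ y ∷ l) = ((y F.< x) ⇔ S 1) × Descents (λ i → S (suc i)) (y ∷ l)

VecDescents : {n m : ℕ} → Vec (Fin n) m → (ℕ → Set) → Set
VecDescents {m = m} w S =
  ∀ (p q : Fin m) → toℕ q ≡ suc (toℕ p) → ((lookup w q F.< lookup w p) ⇔ S (suc (toℕ p)))

descents-toList : {n m : ℕ} (w : Vec (Fin n) m) (S : ℕ → Set) → VecDescents w S ⇔ Descents S (toList w)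
descents-toList {n} w S = mk⇔ (to w S) (from w S)
  where
  to : ∀ {m} (w : Vec (Fin n) m) S → VecDescents w S → Descents S (toList w)
  to [] S d = tt
  to (x ∷ []) S d = tt
  to (x ∷ y ∷ w) S d = d zero (suc zero) refl , to (y ∷ w) (λ i → S (suc i)) (λ p q q≡p+1 → d (suc p) (suc q) (cong suc q≡p+1))
  from : ∀ {m} (w : Vec (Fin n) m) S → Descents S (toList w) → VecDescents w S
  from (x ∷ y ∷ w) S d zero (suc zero) refl = proj₁ d
  from (x ∷ y ∷ w) S d (suc p) (suc q) q≡p+1 = from (y ∷ w) (λ i → S (suc i)) (proj₂ d) p q (ℕP.suc-injective q≡p+1)
  from (x ∷ []) S d zero zero ()
  from (x ∷ y ∷ w) S d zero zero ()
  from (x ∷ y ∷ w) S d zero (suc (suc q)) ()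
  from (x ∷ y ∷ w) S d (suc p) zero ()

_>_ : {n : ℕ} → Fin n → Fin n → Set
a > b = b F.< a

last-of : {A : Set} → A → List A → A
last-of a [] = a
last-of a (x ∷ xs) = last-of x xs

descending⇒descents : {n : ℕ} {S : ℕ → Set} {l : List (Fin n)} → Linked _>_ l → (∀ i → S (suc i)) → Descents S l
descending⇒descents [] all-S = tt
descending⇒descents [-] all-S = tt
descending⇒descents (x>y ∷ dec) all-S = mk⇔ (λ _ → all-S 0) (λ _ → x>y) , descending⇒descents dec (λ i → all-S (suc i))

descents⇒descending : {n : ℕ} {S : ℕ → Set} {l : List (Fin n)} → Descents S l → (∀ i → S (suc i)) → Linked _>_ l
descents⇒descending {l = []} _ all-S = []
descents⇒descending {l = x ∷ []} _ all-S = [-]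
descents⇒descending {l = x ∷ y ∷ l} (first , rest) all-S =
  ⇔.from first (all-S 0) ∷ descents⇒descending rest (λ i → all-S (suc i))

shift-threshold : {S : ℕ → Set} {d : ℕ} → (∀ i → S (suc i) ⇔ suc d ℕ.≤ i) → ∀ i → S (suc (suc i)) ⇔ d ℕ.≤ i
shift-threshold S⇔ i = mk⇔ (λ s → ℕ.s≤s⁻¹ (⇔.to (S⇔ (suc i)) s)) (λ d≤i → ⇔.from (S⇔ (suc i)) (s≤s d≤i))

not-first : {S : ℕ → Set} {d : ℕ} → (∀ i → S (suc i) ⇔ suc d ℕ.≤ i) → ¬ S 1
not-first S⇔ s with ⇔.to (S⇔ 0) s
... | ()

unimodal⇒descents : {n : ℕ} (a : Fin n) (A' B : List (Fin n)) (S : ℕ → Set) →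
  (∀ i → S (suc i) ⇔ length A' ℕ.≤ i) → Linked F._<_ (a ∷ A') → Linked _>_ (last-of a A' ∷ B) → Descents S (a ∷ A' ++ B)
unimodal⇒descents a [] B S S⇔ _ desc = descending⇒descents desc (λ i → ⇔.from (S⇔ i) z≤n)
unimodal⇒descents a (a' ∷ A'') B S S⇔ (a<a' ∷ asc) desc =
  mk⇔ (λ a'<a → ⊥-elim (FP.<-asym a<a' a'<a)) (λ s → ⊥-elim (not-first {S = S} S⇔ s)) ,
  unimodal⇒descents a' A'' B (λ i → S (suc i)) (shift-threshold {S = S} S⇔) asc desc

descents⇒unimodal : {n : ℕ} (a : Fin n) (l' : List (Fin n)) (S : ℕ → Set) (d : ℕ) →
  (∀ i → S (suc i) ⇔ d ℕ.≤ i) → d ℕ.≤ length l' → Unique (a ∷ l') → Descents S (a ∷ l') →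
  ∃₂ λ A' B → l' ≡ A' ++ B × length A' ≡ d × Linked F._<_ (a ∷ A') × Linked _>_ (last-of a A' ∷ B)
descents⇒unimodal a l' S zero S⇔ _ _ desc = [] , l' , refl , refl , [-] , descents⇒descending desc (λ i → ⇔.from (S⇔ i) z≤n)
descents⇒unimodal a (a' ∷ l'') S (suc d) S⇔ (s≤s d≤l'') ((a≢a' ∷ _) ∷ u) (first , desc) with FP.<-cmp a a'
... | tri≈ _ a≡a' _ = ⊥-elim (a≢a' a≡a')
... | tri> _ _ a'<a = ⊥-elim (not-first {S = S} S⇔ (⇔.to first a'<a))
... | tri< a<a' _ _ with descents⇒unimodal a' l'' (λ i → S (suc i)) d (shift-threshold {S = S} S⇔) d≤l'' u desc
...   | A'' , B , l''≡ , len , asc , dec = a' ∷ A'' , B , cong (a' ∷_) l''≡ , cong suc len , a<a' ∷ asc , dec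

last-of-maximum : {n : ℕ} (a : Fin n) (A' : List (Fin n)) → AllPairs F._<_ (a ∷ A') → ∀ {z} → z ∈ a ∷ A' → z F.≤ last-of a A'
last-of-maximum a [] _ (here refl) = FP.≤-refl
last-of-maximum a (a' ∷ A'') (a<A' ∷ asc) (here refl) =
  ℕP.<⇒≤ (ℕP.<-≤-trans (All.head a<A') (last-of-maximum a' A'' asc (here refl)))
last-of-maximum a (a' ∷ A'') (_ ∷ asc) (there z∈) = last-of-maximum a' A'' asc z∈

opposite-reverses-< : {n : ℕ} {i j : Fin n} → i F.< j → F.opposite j F.< F.opposite i
opposite-reverses-< {n} {i} {j} i<j rewrite FP.opposite-prop i | FP.opposite-prop j =
  ℕP.∸-monoʳ-< (s≤s i<j) (FP.toℕ<n j)

-- Peak words.  For a set s of labels, 'peakWord s' lists the labels outside s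
-- increasingly and then those in s decreasingly.  Words with descent set
-- {n-k, …, n-1} are exactly the peak words of k-sets avoiding the top label.
module PeakWords {n : ℕ} where
  open DecMembership (FP._≟_ {n}) using (_∈?_)

  ascending-part : List (Fin n) → List (Fin n)
  ascending-part s = filter (λ x → ¬? (x ∈? s)) (L.allFin n)

  descending-part : List (Fin n) → List (Fin n)
  descending-part s = filter (_∈? s) (L.tabulate F.opposite)

  peakWord : List (Fin n) → List (Fin n)
  peakWord s = ascending-part s ++ descending-part s

  ∈-ascending-part : ∀ s x → x ∈ ascending-part s ⇔ x ∉ s
  ∈-ascending-part s x = mk⇔ (λ x∈ → proj₂ (∈-filter⁻ (λ x → ¬? (x ∈? s)) {xs = L.allFin n} x∈))
                             (∈-filter⁺ (λ x → ¬? (x ∈? s)) (∈-allFin x))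

  ∈-descending-part : ∀ s x → x ∈ descending-part s ⇔ x ∈ s
  ∈-descending-part s x = mk⇔ (λ x∈ → proj₂ (∈-filter⁻ (_∈? s) {xs = L.tabulate F.opposite} x∈))
                              (∈-filter⁺ (_∈? s) x∈reversed)
    where
    x∈reversed : x ∈ L.tabulate F.opposite
    x∈reversed = subst (_∈ L.tabulate F.opposite) (FP.opposite-involutive x) (∈-tabulate⁺ (F.opposite x))

  ascending-part-sorted : ∀ s → AllPairs F._<_ (ascending-part s)
  ascending-part-sorted s = APP.filter⁺ (λ x → ¬? (x ∈? s)) (APP.tabulate⁺-< (λ i<j → i<j))

  descending-part-sorted : ∀ s → AllPairs _>_ (descending-part s)
  descending-part-sorted s = APP.filter⁺ (_∈? s) (APP.tabulate⁺-< {f = F.opposite} opposite-reverses-<)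

  peakWord-unique : ∀ s → Unique (peakWord s)
  peakWord-unique s = APP.++⁺ (AP.map FP.<⇒≢ (ascending-part-sorted s))
    (AP.map (λ x>y x≡y → FP.<⇒≢ x>y (sym x≡y)) (descending-part-sorted s))
    (All.tabulate λ {x} x∈A → All.tabulate λ {y} y∈B x≡y →
      ⇔.to (∈-ascending-part s x) x∈A (subst (_∈ s) (sym x≡y) (⇔.to (∈-descending-part s y) y∈B)))

  ∈-peakWord : ∀ s x → x ∈ peakWord s
  ∈-peakWord s x with x ∈? s
  ... | yes x∈s = ∈-++⁺ʳ (ascending-part s) (⇔.from (∈-descending-part s x) x∈s)
  ... | no x∉s = ∈-++⁺ˡ (⇔.from (∈-ascending-part s x) x∉s)

  length-peakWord : ∀ s → length (peakWord s) ≡ n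
  length-peakWord s =
    trans (unique-length (peakWord-unique s) (UP.allFin⁺ n) (λ z → mk⇔ (λ _ → ∈-allFin z) (λ _ → ∈-peakWord s z)))
          (LP.length-tabulate (λ x → x))

  length-descending-part : ∀ {s} → Unique s → length (descending-part s) ≡ length s
  length-descending-part {s} u =
    unique-length (AP.map (λ x>y x≡y → FP.<⇒≢ x>y (sym x≡y)) (descending-part-sorted s)) u (∈-descending-part s)

  peakWord-cong : ∀ {s t} → (∀ z → z ∈ s ⇔ z ∈ t) → peakWord s ≡ peakWord t
  peakWord-cong {s} {t} same = cong₂ _++_
    (LP.filter-≐ (λ x → ¬? (x ∈? s)) (λ x → ¬? (x ∈? t))
       ((λ x∉s x∈t → x∉s (⇔.from (same _) x∈t)) , (λ x∉t x∈s → x∉t (⇔.to (same _) x∈s))) (L.allFin n))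
    (LP.filter-≐ (_∈? s) (_∈? t) ((λ x∈s → ⇔.to (same _) x∈s) , (λ x∈t → ⇔.from (same _) x∈t)) (L.tabulate F.opposite))

  sorted-split≡peakWord : ∀ A B → Unique (A ++ B) → (∀ z → z ∈ A ++ B) →
    AllPairs F._<_ A → AllPairs _>_ B → A ++ B ≡ peakWord B
  sorted-split≡peakWord A B u complete asc desc = cong₂ _++_
    (sorted-unique FP.<-asym asc (ascending-part-sorted B) (λ z → mk⇔ (outside z) (inside z)))
    (sorted-unique (λ x>y y>x → FP.<-asym x>y y>x) desc (descending-part-sorted B) (λ z → mk⇔ (⇔.from (∈-descending-part B z)) (⇔.to (∈-descending-part B z))))
    where
    A∩B-empty : All (λ x → All (x ≢_) B) A
    A∩B-empty = proj₂ (proj₂ (AllPairs-++⁻ A u))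
    outside : ∀ z → z ∈ A → z ∈ ascending-part B
    outside z z∈A = ⇔.from (∈-ascending-part B z) (λ z∈B → All.lookup (All.lookup A∩B-empty z∈A) z∈B refl)
    inside : ∀ z → z ∈ ascending-part B → z ∈ A
    inside z z∈asc with ∈-++⁻ A (complete z)
    ... | inj₁ z∈A = z∈A
    ... | inj₂ z∈B = ⊥-elim (⇔.to (∈-ascending-part B z) z∈asc z∈B)

  peakWord-injective : ∀ {s t} → Unique s → Unique t → length s ≡ length t →
    peakWord s ≡ peakWord t → ∀ z → z ∈ s ⇔ z ∈ t
  peakWord-injective {s} {t} us ut len same z =
    mk⇔ (λ z∈s → ⇔.to (∈-descending-part t z) (subst (z ∈_) descending≡ (⇔.from (∈-descending-part s z) z∈s)))
        (λ z∈t → ⇔.to (∈-descending-part s z) (subst (z ∈_) (sym descending≡) (⇔.from (∈-descending-part t z) z∈t)))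
    where
    descending-lengths : length (descending-part s) ≡ length (descending-part t)
    descending-lengths = trans (length-descending-part us) (trans len (sym (length-descending-part ut)))
    ascending-lengths : length (ascending-part s) ≡ length (ascending-part t)
    ascending-lengths = ℕP.+-cancelʳ-≡ (length (descending-part s)) _ _ (begin
      length (ascending-part s) + length (descending-part s) ≡⟨ LP.length-++ (ascending-part s) ⟨
      length (peakWord s)                                   ≡⟨ cong length same ⟩
      length (peakWord t)                                   ≡⟨ LP.length-++ (ascending-part t) ⟩
      length (ascending-part t) + length (descending-part t) ≡⟨ cong (length (ascending-part t) +_) descending-lengths ⟨
      length (ascending-part t) + length (descending-part s) ∎)
      where open ≡-Reasoning
    descending≡ : descending-part s ≡ descending-part t
    descending≡ = ++-cancel-length (ascending-part s) (ascending-part t) ascending-lengths same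

open PeakWords public

top : {m : ℕ} → Fin (suc m)
top {m} = F.fromℕ m

below-top : {m : ℕ} (x : Fin (suc m)) → x ≢ top → x F.< top
below-top x x≢top = FP.≤∧≢⇒< (FP.≤fromℕ x) x≢top

final-segment-threshold : {m k d : ℕ} → d + k ≡ m → ∀ i → FinalSegment (suc m) k (suc i) ⇔ d ℕ.≤ i
final-segment-threshold {k = k} {d} refl i rewrite ℕP.m+n∸n≡m (suc d) k = mk⇔ ℕ.s≤s⁻¹ s≤s

nonempty : {A : Set} {x : A} {xs : List A} → x ∈ xs → ∃₂ λ a as → xs ≡ a ∷ as
nonempty {xs = a ∷ as} _ = a , as , refl

-- Peak words of k-sets avoiding the top label have descent set {n-k, …, n-1}:
-- the ascending part ends with the top label and has length n - k.
peakWord-descents : {m k : ℕ} (s : List (Fin (suc m))) → top ∉ s → length (descending-part s) ≡ k →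
  Descents (FinalSegment (suc m) k) (peakWord s)
peakWord-descents {m} {k} s top∉s len with nonempty (⇔.from (∈-ascending-part s top) top∉s)
... | a , A' , asc≡ =
  subst (λ A → Descents (FinalSegment (suc m) k) (A ++ D)) (sym asc≡)
    (unimodal⇒descents a A' D _ (final-segment-threshold lengths) (LinkedP.AllPairs⇒Linked sorted) peak)
  where
  D : List (Fin (suc m))
  D = descending-part s
  sorted : AllPairs F._<_ (a ∷ A')
  sorted = subst (AllPairs F._<_) asc≡ (ascending-part-sorted s)
  lengths : length A' + k ≡ m
  lengths = ℕP.suc-injective (begin
    length (a ∷ A') + k                ≡⟨ cong₂ (λ A d → length A + d) (sym asc≡) (sym len) ⟩
    length (ascending-part s) + length D ≡⟨ LP.length-++ (ascending-part s) ⟨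
    length (peakWord s)                 ≡⟨ length-peakWord s ⟩
    suc m ∎)
    where open ≡-Reasoning
  last≡top : last-of a A' ≡ top
  last≡top = FP.≤-antisym (FP.≤fromℕ _)
    (last-of-maximum a A' sorted (subst (top ∈_) asc≡ (⇔.from (∈-ascending-part s top) top∉s)))
  peak : Linked _>_ (last-of a A' ∷ D)
  peak rewrite last≡top = LinkedP.AllPairs⇒Linked
    (All.tabulate (λ {y} y∈D → below-top y (λ y≡top → top∉s (subst (_∈ s) y≡top (⇔.to (∈-descending-part s y) y∈D))))
     ∷ descending-part-sorted s)

descents⇒peakWord : {m k : ℕ} → k ℕ.≤ m → (l : List (Fin (suc m))) → length l ≡ suc m → Unique l →
  (∀ z → z ∈ l) → Descents (FinalSegment (suc m) k) l →
  ∃ λ B → l ≡ peakWord B × Unique B × top ∉ B × length B ≡ k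
descents⇒peakWord {m} {k} k≤m (a ∷ l') len u complete desc
  with descents⇒unimodal a l' _ (m ∸ k) (final-segment-threshold (ℕP.m∸n+n≡m k≤m)) short u desc
  where
  short : m ∸ k ℕ.≤ length l'
  short = subst (m ∸ k ℕ.≤_) (sym (ℕP.suc-injective len)) (ℕP.m∸n≤m m k)
... | A' , B , l'≡ , lenA' , asc , dec =
  B , l≡peakWord , proj₁ (proj₂ (AllPairs-++⁻ (a ∷ A') u')) , top∉B , lenB
  where
  l≡split : a ∷ l' ≡ (a ∷ A') ++ B
  l≡split = cong (a ∷_) l'≡
  u' : Unique ((a ∷ A') ++ B)
  u' = subst Unique l≡split u
  ascending : AllPairs F._<_ (a ∷ A')
  ascending = LinkedP.Linked⇒AllPairs FP.<-trans asc
  descending : AllPairs _>_ (last-of a A' ∷ B)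
  descending = LinkedP.Linked⇒AllPairs (λ x>y y>z → FP.<-trans y>z x>y) dec
  l≡peakWord : a ∷ l' ≡ peakWord B
  l≡peakWord = trans l≡split (sorted-split≡peakWord (a ∷ A') B u'
    (λ z → subst (z ∈_) l≡split (complete z)) ascending (AP.tail descending))
  top∉B : top ∉ B
  top∉B top∈B = ℕP.<⇒≱ (All.lookup (AP.head descending) top∈B) (FP.≤fromℕ (last-of a A'))
  lenB : length B ≡ k
  lenB = ℕP.+-cancelˡ-≡ (m ∸ k) (length B) k (begin
    m ∸ k + length B         ≡⟨ cong (_+ length B) lenA' ⟨
    length A' + length B     ≡⟨ LP.length-++ A' ⟨
    length (A' ++ B)         ≡⟨ cong length l'≡ ⟨
    length l'                ≡⟨ ℕP.suc-injective len ⟩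
    m                        ≡⟨ ℕP.m∸n+n≡m k≤m ⟨
    m ∸ k + k ∎)
    where open ≡-Reasoning

-- Part (b) is
-- reduced to part (a) for a dual relation, so the counting argument is stated
-- for any relation compatible with the labelling; no partial-order axiom is used.

Relation : ℕ → Set₁
Relation n = Fin n → Fin n → Set

Natural : {n : ℕ} → Relation n → Set
Natural _≼_ = ∀ {x y} → x ≼ y → x F.≤ y

Maximal : {n : ℕ} → Relation n → Fin n → Set
Maximal _≼_ x = ∀ y → x ≼ y → y ≡ x

Compatible : {n : ℕ} → Relation n → List (Fin n) → Set
Compatible _≼_ = AllPairs (λ a b → ¬ (b ≼ a))

LinearExtensionOf : {n : ℕ} → Relation n → Vec (Fin n) n → Set
LinearExtensionOf _≼_ w = IsPermutation w × (∀ p q → lookup w p ≼ lookup w q → p F.≤ q)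

top-maximal : {m : ℕ} {_≼_ : Relation (suc m)} → Natural _≼_ → Maximal _≼_ top
top-maximal natural y top≼y = FP.≤-antisym (FP.≤fromℕ y) (natural top≼y)

permutation⇔unique : {A : Set} {m : ℕ} (w : Vec A m) →
  (∀ p q → lookup w p ≡ lookup w q → p ≡ q) ⇔ Unique (toList w)
permutation⇔unique w = mk⇔
  (λ perm → ⇔.from (AllPairs-toList w) (λ p q p<q wp≡wq → FP.<⇒≢ p<q (perm p q wp≡wq)))
  (λ u p q wp≡wq → distinct-positions (⇔.to (AllPairs-toList w) u) p q wp≡wq)
  where
  distinct-positions : (∀ p q → p F.< q → lookup w p ≢ lookup w q) → ∀ p q → lookup w p ≡ lookup w q → p ≡ q
  distinct-positions apart p q wp≡wq with FP.<-cmp p q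
  ... | tri< p<q _ _ = ⊥-elim (apart p q p<q wp≡wq)
  ... | tri≈ _ p≡q _ = p≡q
  ... | tri> _ _ q<p = ⊥-elim (apart q p q<p (sym wp≡wq))

extension⇔compatible : {n m : ℕ} {_≼_ : Relation n} (w : Vec (Fin n) m) →
  (∀ p q → lookup w p ≼ lookup w q → p F.≤ q) ⇔ Compatible _≼_ (toList w)
extension⇔compatible {_≼_ = _≼_} w = mk⇔
  (λ ext → ⇔.from (AllPairs-toList w) (λ p q p<q wq≼wp → ℕP.<⇒≱ p<q (ext q p wq≼wp)))
  (λ compat → ordered (⇔.to (AllPairs-toList w) compat))
  where
  ordered : (∀ p q → p F.< q → ¬ (lookup w q ≼ lookup w p)) → ∀ p q → lookup w p ≼ lookup w q → p F.≤ q
  ordered never-back p q wp≼wq with toℕ p ℕ.≤? toℕ q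
  ... | yes p≤q = p≤q
  ... | no p≰q = ⊥-elim (never-back q p (ℕP.≰⇒> p≰q) wp≼wq)

-- A peak word is compatible with a natural ≼ when the letters of its
-- descending part are maximal: only maximal letters ever precede larger ones.
peakWord-compatible : {n : ℕ} {_≼_ : Relation n} → Natural _≼_ → (s : List (Fin n)) →
  (∀ {x} → x ∈ s → Maximal _≼_ x) → Compatible _≼_ (peakWord s)
peakWord-compatible {_≼_ = _≼_} natural s maximal = APP.++⁺
  (AP.map (λ a<b b≼a → ℕP.<⇒≱ a<b (natural b≼a)) (ascending-part-sorted s))
  (AllPairs-map-members (descending-part-sorted s)
    (λ {a} {b} _ b∈ a>b b≼a → FP.<⇒≢ a>b (sym (maximal (⇔.to (∈-descending-part s b) b∈) a b≼a))))
  (All.tabulate λ {a} a∈ → All.tabulate λ {b} b∈ b≼a →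
    ⇔.to (∈-ascending-part s a) a∈ (subst (_∈ s) (sym (maximal (⇔.to (∈-descending-part s b) b∈) a b≼a)) (⇔.to (∈-descending-part s b) b∈)))

compatible⇒maximal : {n : ℕ} {_≼_ : Relation n} → Natural _≼_ → (s : List (Fin n)) →
  Compatible _≼_ (peakWord s) → ∀ {b} → b ∈ s → Maximal _≼_ b
compatible⇒maximal {_≼_ = _≼_} natural s compat {b} b∈s y b≼y = decide (y FP.≟ b)
  where
  across : All (λ a → All (λ c → ¬ (c ≼ a)) (descending-part s)) (ascending-part s)
  across = proj₂ (proj₂ (AllPairs-++⁻ (ascending-part s) compat))
  within : Compatible _≼_ (descending-part s)
  within = proj₁ (proj₂ (AllPairs-++⁻ (ascending-part s) compat))
  b∈desc : b ∈ descending-part s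
  b∈desc = ⇔.from (∈-descending-part s b) b∈s
  -- every letter of the descending part comes after the ascending part and,
  -- within it, after every larger letter
  placed : y ≢ b → y ∈ ascending-part s ⊎ y ∈ descending-part s → y ≡ b
  placed _ (inj₁ y∈asc) = ⊥-elim (All.lookup (All.lookup across y∈asc) b∈desc b≼y)
  placed y≢b (inj₂ y∈desc) with AllPairs-either (AP.zip (within , descending-part-sorted s)) y∈desc b∈desc y≢b
  ... | inj₁ (b⋠y , _) = ⊥-elim (b⋠y b≼y)
  ... | inj₂ (_ , y<b) = ⊥-elim (ℕP.<⇒≱ y<b (natural b≼y))
  decide : Dec (y ≡ b) → y ≡ b
  decide (yes y≡b) = y≡b
  decide (no y≢b) = placed y≢b (∈-++⁻ (ascending-part s) (∈-peakWord s y))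

module PeakExtensions {m : ℕ} {_≼_ : Relation (suc m)} (natural : Natural _≼_) (k : ℕ) (k≤m : k ℕ.≤ m) where

  PeakExtension : Vec (Fin (suc m)) (suc m) → Set
  PeakExtension w = LinearExtensionOf _≼_ w × DescentSetIs w (FinalSegment (suc m) k)

  Eligible : Fin (suc m) → Set
  Eligible x = Maximal _≼_ x × x ≢ top

  word : List (Fin (suc m)) → Vec (Fin (suc m)) (suc m)
  word s = listToVec (peakWord s) (length-peakWord s)

  letters-of-word : ∀ s → toList (word s) ≡ peakWord s
  letters-of-word s = toList-listToVec (peakWord s) (length-peakWord s)

  module _ {E : List (Fin (suc m))} (uE : Unique E) (∈E : ∀ x → x ∈ E ⇔ Eligible x) where

    word-extension : ∀ {s} → s ∈ choose k E → PeakExtension (word s)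
    word-extension {s} s∈ =
      ( ⇔.from (permutation⇔unique (word s)) (subst Unique (sym letters) (peakWord-unique s))
      , ⇔.from (extension⇔compatible (word s)) (subst (Compatible _≼_) (sym letters)
          (peakWord-compatible natural s (λ x∈s → proj₁ (eligible x∈s)))))
      , ⇔.from (descents-toList (word s) _) (subst (Descents _) (sym letters)
          (peakWord-descents s (λ top∈s → proj₂ (eligible top∈s) refl)
            (trans (length-descending-part (choose-element-unique k E uE s∈)) (choose-length k E s∈))))
      where
      letters : toList (word s) ≡ peakWord s
      letters = letters-of-word s
      eligible : ∀ {x} → x ∈ s → Eligible x
      eligible x∈s = ⇔.to (∈E _) (choose-⊆ k E s∈ x∈s)

    extension-word : ∀ w → PeakExtension w → ∃ λ s → s ∈ choose k E × w ≡ word s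
    extension-word w ((perm , ext) , desc)
      with descents⇒peakWord k≤m (toList w) (VP.length-toList w) unique complete (⇔.to (descents-toList w _) desc)
      where
      unique : Unique (toList w)
      unique = ⇔.to (permutation⇔unique w) perm
      complete : ∀ z → z ∈ toList w
      complete z with injective⇒surjective (lookup w) perm z
      ... | p , refl = ∈-toList⁺ (∈-lookupᵥ p w)
    ... | B , w≡B , uB , top∉B , lenB with choose-complete FP._≟_ k E uE uB B⊆E lenB
      where
      maximal : ∀ {x} → x ∈ B → Maximal _≼_ x
      maximal = compatible⇒maximal natural B (subst (Compatible _≼_) w≡B (⇔.to (extension⇔compatible w) ext))
      B⊆E : ∀ {x} → x ∈ B → x ∈ E
      B⊆E x∈B = ⇔.from (∈E _) (maximal x∈B , λ x≡top → top∉B (subst (_∈ B) x≡top x∈B))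
    ... | s , s∈ , same = s , s∈ , toList-injective w (word s) (begin
      toList w        ≡⟨ w≡B ⟩
      peakWord B      ≡⟨ peakWord-cong same ⟨
      peakWord s      ≡⟨ letters-of-word s ⟨
      toList (word s) ∎)
      where open ≡-Reasoning

    word-injective : ∀ {a b} → a ∈ choose k E → b ∈ choose k E → word a ≡ word b → a ≡ b
    word-injective {a} {b} a∈ b∈ same = choose-members-injective k E uE a∈ b∈
      (peakWord-injective (choose-element-unique k E uE a∈) (choose-element-unique k E uE b∈)
        (trans (choose-length k E a∈) (sym (choose-length k E b∈)))
        (trans (sym (letters-of-word a)) (trans (cong toList same) (letters-of-word b))))

  count-peak-extensions : ∀ {c} → HasExactly Eligible c → HasExactly PeakExtension (c C k)
  count-peak-extensions (E , uE , ∈E , refl) =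
    subst (HasExactly PeakExtension) (length-choose k E)
      (count-image word (choose k E) (choose-unique k E uE) (word-injective uE ∈E)
        (λ w → mk⇔ (extension-word uE ∈E w) λ { (s , s∈ , refl) → word-extension uE ∈E s∈ }))

-- Duality.

Minimal : {n : ℕ} → Relation n → Fin n → Set
Minimal _≼_ x = ∀ y → y ≼ x → y ≡ x

Dual : {n : ℕ} → Relation n → Relation n
Dual _≼_ x y = F.opposite y ≼ F.opposite x

opposite-injective : {n : ℕ} {x y : Fin n} → F.opposite x ≡ F.opposite y → x ≡ y
opposite-injective {x = x} {y} same =
  trans (sym (FP.opposite-involutive x)) (trans (cong F.opposite same) (FP.opposite-involutive y))

opposite-reflects-≤ : {n : ℕ} {x y : Fin n} → F.opposite y F.≤ F.opposite x → x F.≤ y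
opposite-reflects-≤ {x = x} {y} opp≤ with toℕ x ℕ.≤? toℕ y
... | yes x≤y = x≤y
... | no x≰y = ⊥-elim (ℕP.<⇒≱ (opposite-reverses-< (ℕP.≰⇒> x≰y)) opp≤)

dual-natural : {n : ℕ} {_≼_ : Relation n} → Natural _≼_ → Natural (Dual _≼_)
dual-natural natural y≼x = opposite-reflects-≤ (natural y≼x)

minimal⇔dual-maximal : {n : ℕ} {_≼_ : Relation n} (x : Fin n) → Minimal _≼_ x ⇔ Maximal (Dual _≼_) (F.opposite x)
minimal⇔dual-maximal {_≼_ = _≼_} x = mk⇔
  (λ minimal y oy≼oox → opposite-injective (trans (minimal (F.opposite y) (subst (F.opposite y ≼_) (FP.opposite-involutive x) oy≼oox))
                                              (sym (FP.opposite-involutive x))))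
  (λ maximal y y≼x → opposite-injective (maximal (F.opposite y)
     (subst₂ _≼_ (sym (FP.opposite-involutive y)) (sym (FP.opposite-involutive x)) y≼x)))

module Reversal {n : ℕ} where
  opp : Fin n → Fin n
  opp = F.opposite

  reverse-complement : Vec (Fin n) n → Vec (Fin n) n
  reverse-complement w = V.tabulate (λ i → opp (lookup w (opp i)))

  lookup-reverse-complement : ∀ w i → lookup (reverse-complement w) i ≡ opp (lookup w (opp i))
  lookup-reverse-complement w i = VP.lookup∘tabulate _ i

  reverse-complement-involutive : ∀ w → reverse-complement (reverse-complement w) ≡ w
  reverse-complement-involutive w = trans
    (VP.tabulate-cong (λ i → trans (cong opp (lookup-reverse-complement w (opp i)))
      (trans (FP.opposite-involutive _) (cong (lookup w) (FP.opposite-involutive i)))))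
    (VP.tabulate∘lookup w)

  reverse-complement-permutation : ∀ w → IsPermutation w → IsPermutation (reverse-complement w)
  reverse-complement-permutation w perm p q same = opposite-injective (perm (opp p) (opp q) (opposite-injective
    (trans (sym (lookup-reverse-complement w p)) (trans same (lookup-reverse-complement w q)))))

  reverse-complement-extension : {_≼₁_ _≼₂_ : Relation n} → (∀ {x y} → x ≼₁ y → opp y ≼₂ opp x) →
    ∀ w → LinearExtensionOf _≼₂_ w → LinearExtensionOf _≼₁_ (reverse-complement w)
  reverse-complement-extension {_≼₁_} {_≼₂_} flip w (perm , ext) = reverse-complement-permutation w perm , ext'
    where
    ext' : ∀ p q → lookup (reverse-complement w) p ≼₁ lookup (reverse-complement w) q → p F.≤ q
    ext' p q rp≼rq = opposite-reflects-≤ (ext (opp q) (opp p) (subst₂ _≼₂_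
      (trans (cong opp (lookup-reverse-complement w q)) (FP.opposite-involutive _))
      (trans (cong opp (lookup-reverse-complement w p)) (FP.opposite-involutive _)) (flip rp≼rq)))

  -- The adjacent positions p, p + 1 (0-based) mirror to the adjacent positions
  -- n - p - 2, n - p - 1; as 1-based descent positions, i = p + 1 becomes n - i.
  mirrored-positions : ∀ (p q : Fin n) → toℕ q ≡ suc (toℕ p) →
    toℕ (opp p) ≡ suc (toℕ (opp q)) × suc (toℕ (opp q)) + suc (toℕ p) ≡ n
  mirrored-positions p q q≡p+1 rewrite FP.opposite-prop p | FP.opposite-prop q | q≡p+1 =
    ℕP.+-∸-assoc 1 p+2≤n , trans (cong (_+ suc (toℕ p)) (sym (ℕP.+-∸-assoc 1 p+2≤n))) (ℕP.m∸n+n≡m (ℕP.<⇒≤ p+2≤n))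
    where
    p+2≤n : suc (suc (toℕ p)) ℕ.≤ n
    p+2≤n = subst (λ t → suc t ℕ.≤ n) q≡p+1 (FP.toℕ<n q)

  reverse-complement-descents : {S T : ℕ → Set} → (∀ a b → a + b ≡ n → S a ⇔ T b) →
    ∀ w → VecDescents w S → VecDescents (reverse-complement w) T
  reverse-complement-descents mirror w desc p q q≡p+1 with mirrored-positions p q q≡p+1
  ... | opp-p≡ , sum = mk⇔
    (λ rq<rp → ⇔.to (mirror _ _ sum) (⇔.to (desc (opp q) (opp p) opp-p≡) (reflect (rewrite-lookups rq<rp))))
    (λ t → unrewrite-lookups (opposite-reverses-< (⇔.from (desc (opp q) (opp p) opp-p≡) (⇔.from (mirror _ _ sum) t))))
    where
    rewrite-lookups : lookup (reverse-complement w) q F.< lookup (reverse-complement w) p →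
      opp (lookup w (opp q)) F.< opp (lookup w (opp p))
    rewrite-lookups = subst₂ F._<_ (lookup-reverse-complement w q) (lookup-reverse-complement w p)
    unrewrite-lookups : opp (lookup w (opp q)) F.< opp (lookup w (opp p)) →
      lookup (reverse-complement w) q F.< lookup (reverse-complement w) p
    unrewrite-lookups = subst₂ F._<_ (sym (lookup-reverse-complement w q)) (sym (lookup-reverse-complement w p))
    reflect : ∀ {a b} → opp a F.< opp b → b F.< a
    reflect {a} {b} oa<ob = subst₂ F._<_ (FP.opposite-involutive b) (FP.opposite-involutive a) (opposite-reverses-< oa<ob)

open Reversal public

final⇔initial : {n : ℕ} (k a b : ℕ) → a + b ≡ n → FinalSegment n k a ⇔ InitialSegment k b
final⇔initial k a b refl = mk⇔ to from
  where
  to : a + b ∸ k ℕ.≤ a → b ℕ.≤ k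
  to n-k≤a with b ℕ.≤? k
  ... | yes b≤k = b≤k
  ... | no b≰k = ⊥-elim (ℕP.<⇒≱ (subst (ℕ._< a + b ∸ k) (ℕP.m+n∸n≡m a b) (ℕP.∸-monoʳ-< (ℕP.≰⇒> b≰k) (ℕP.m≤n+m b a))) n-k≤a)
  from : b ℕ.≤ k → a + b ∸ k ℕ.≤ a
  from b≤k = subst (a + b ∸ k ℕ.≤_) (ℕP.m+n∸n≡m a b) (ℕP.∸-monoʳ-≤ (a + b) b≤k)

-- Part (a) for any natural relation: the top label is always maximal, so
-- j maximal elements leave j - 1 eligible ones.
count-final-descents : {m : ℕ} {_≼_ : Relation (suc m)} → Natural _≼_ → (k : ℕ) → k ℕ.≤ m →
  ∀ j → HasExactly (Maximal _≼_) j →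
  HasExactly (λ w → LinearExtensionOf _≼_ w × DescentSetIs w (FinalSegment (suc m) k)) ((j ∸ 1) C k)
count-final-descents natural k k≤m j maxima =
  PeakExtensions.count-peak-extensions natural k k≤m (count-remove FP._≟_ (top-maximal natural) maxima)

count-initial-descents : {m : ℕ} {_≼_ : Relation (suc m)} → Natural _≼_ → (k : ℕ) → k ℕ.≤ m →
  ∀ j → HasExactly (Minimal _≼_) j →
  HasExactly (λ w → LinearExtensionOf _≼_ w × DescentSetIs w (InitialSegment k)) ((j ∸ 1) C k)
count-initial-descents {m} {_≼_} natural k k≤m j minima =
  count-involution reverse-complement reverse-complement-involutive dualise
    (count-final-descents (dual-natural natural) k k≤m j
      (count-involution F.opposite FP.opposite-involutive minimal⇔dual-maximal minima))
  where
  into-double-dual : ∀ {x y} → x ≼ y → Dual (Dual _≼_) x y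
  into-double-dual = subst₂ _≼_ (sym (FP.opposite-involutive _)) (sym (FP.opposite-involutive _))
  initial⇔final : ∀ a b → a + b ≡ suc m → InitialSegment k a ⇔ FinalSegment (suc m) k b
  initial⇔final a b a+b≡n = mk⇔ (⇔.from mirror) (⇔.to mirror)
    where
    mirror : FinalSegment (suc m) k b ⇔ InitialSegment k a
    mirror = final⇔initial k b a (trans (ℕP.+-comm b a) a+b≡n)
  dualise : ∀ u → (LinearExtensionOf (Dual _≼_) u × DescentSetIs u (FinalSegment (suc m) k)) ⇔
    (LinearExtensionOf _≼_ (reverse-complement u) × DescentSetIs (reverse-complement u) (InitialSegment k))
  dualise u = mk⇔
    (λ (ext , desc) → reverse-complement-extension {_≼₁_ = _≼_} {_≼₂_ = Dual _≼_} into-double-dual u ext , reverse-complement-descents (final⇔initial k) u desc)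
    (λ (ext , desc) → subst (λ v → LinearExtensionOf (Dual _≼_) v × DescentSetIs v (FinalSegment (suc m) k))
       (reverse-complement-involutive u)
       (reverse-complement-extension {_≼₁_ = Dual _≼_} {_≼₂_ = _≼_} (λ x≼'y → x≼'y) (reverse-complement u) ext ,
        reverse-complement-descents {S = InitialSegment k} initial⇔final (reverse-complement u) desc))

lemma3p1 : (n : ℕ) (P : NatLabeledPoset n) (k : ℕ) → k < n →
    (∀ (j : ℕ) → HasExactly (IsMaximal P) j →
       HasExactly (λ (w : Vec (Fin n) n) → IsLinearExtension P w × DescentSetIs w (FinalSegment n k)) ((j ∸ 1) C k))
    × (∀ (j : ℕ) → HasExactly (IsMinimal P) j →
       HasExactly (λ (w : Vec (Fin n) n) → IsLinearExtension P w × DescentSetIs w (InitialSegment k)) ((j ∸ 1) C k))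
lemma3p1 zero P k ()
lemma3p1 (suc m) P k k<n =
  count-final-descents (natural P) k k≤m , count-initial-descents (natural P) k k≤m
  where
  k≤m : k ℕ.≤ m
  k≤m = ℕ.s≤s⁻¹ k<n
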